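{- Let $\pi$ be a plane partition with at most $b$ nonzero rows and all entries at most $c$, and let $D=\Phi(\pi)=(d_{i\ell})$, viewed as a $b\times c$ matrix. (i) For every $\ell\ge1$, the number $c_\ell(\pi)$ of columns of $\pi$ containing the entry $\ell$ equals the column sum $c_\ell(D)=\sum_i d_{i\ell}$. (ii) Let $\lambda=\mathrm{sh}(\pi)$ be the shape of $\pi$, i.e. $\lambda_k=|\{j:\pi_{kj}>0\}|$. Then for every $k$ with $1\le k\le b$, $$\lambda_k=\max_{\Pi:(k,1)\to(b,c)}\sum_{(i,\ell)\in\Pi}d_{i\ell},$$ where the maximum is over monotone lattice paths $\Pi$ from $(k,1)$ to $(b,c)$ using steps $(i,\ell)\to(i+1,\ell)$ and $(i,\ell)\to(i,\ell+1)$.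
   Context: A plane partition is an array $\pi=(\pi_{ij})_{i,j\ge1}$ of nonnegative integers with finitely many nonzero entries, weakly decreasing along rows and columns. The map $\Phi$ sends $\pi$ to the matrix $(d_{i\ell})_{i,\ell\ge1}$ with $d_{i\ell}=|\{j:\pi_{ij}=\ell>\pi_{i+1,j}\}|$. -}

module Defs where

open import Data.Nat using (ℕ; zero; suc; _+_; _≤_; _<_; _≡ᵇ_; _<ᵇ_)
open import Data.Bool using (Bool; true; false; _∧_; _∨_; if_then_else_)
open import Relation.Binary.PropositionalEquality using (_≡_)
open import Data.Product using (_×_; Σ)

-- All indices are 1-based, as in the paper; index 0 is never read.

count : (ℕ → Bool) → ℕ → ℕ
count f zero    = 0
count f (suc n) = (if f (suc n) then 1 else 0) + count f n

anyUpTo : (ℕ → Bool) → ℕ → Bool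
anyUpTo f zero    = false
anyUpTo f (suc n) = f (suc n) ∨ anyUpTo f n

sumUpTo : (ℕ → ℕ) → ℕ → ℕ
sumUpTo f zero    = 0
sumUpTo f (suc n) = f (suc n) + sumUpTo f n

record PlanePartition : Set where
  field
    entry   : ℕ → ℕ → ℕ
    rowDec  : ∀ i j → 1 ≤ i → 1 ≤ j → entry i (suc j) ≤ entry i j
    colDec  : ∀ i j → 1 ≤ i → 1 ≤ j → entry (suc i) j ≤ entry i j
    width   : ℕ
    height  : ℕ
    widthOK  : ∀ i j → width < j → entry i j ≡ 0
    heightOK : ∀ i j → height < i → entry i j ≡ 0

open PlanePartition public

-- For ℓ ≥ 1 only columns j ≤ width can contribute, so counting over
-- 1 ≤ j ≤ width is exact.  (For ℓ = 0 the paper's set can be infinite;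
-- that entry is never used.)
Φ : PlanePartition → ℕ → ℕ → ℕ
Φ π i ℓ = count (λ j → (entry π i j ≡ᵇ ℓ) ∧ (entry π (suc i) j <ᵇ ℓ)) (width π)

AtMostRows : PlanePartition → ℕ → Set
AtMostRows π b = ∀ i j → b < i → entry π i j ≡ 0

EntriesAtMost : PlanePartition → ℕ → Set
EntriesAtMost π c = ∀ i j → 1 ≤ i → 1 ≤ j → entry π i j ≤ c

-- c_ℓ(π): number of columns j of π containing the entry ℓ (ℓ ≥ 1; then
-- only rows 1..b and columns 1..width can contain ℓ when π has ≤ b nonzero rows).
colsContaining : PlanePartition → ℕ → ℕ → ℕ
colsContaining π b ℓ =
  count (λ j → anyUpTo (λ i → entry π i j ≡ᵇ ℓ) b) (width π)

colSum : (ℕ → ℕ → ℕ) → ℕ → ℕ → ℕ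
colSum D b ℓ = sumUpTo (λ i → D i ℓ) b

shape : PlanePartition → ℕ → ℕ
shape π k = count (λ j → 0 <ᵇ entry π k j) (width π)

data Path (b c : ℕ) : ℕ → ℕ → Set where
  stop  : Path b c b c
  down  : ∀ {i ℓ} → Path b c (suc i) ℓ → Path b c i ℓ
  right : ∀ {i ℓ} → Path b c i (suc ℓ) → Path b c i ℓ

weight : (ℕ → ℕ → ℕ) → ∀ {b c i ℓ} → Path b c i ℓ → ℕ
weight D {b} {c} stop = D b c
weight D {i = i} {ℓ} (down p)  = D i ℓ + weight D p
weight D {i = i} {ℓ} (right p) = D i ℓ + weight D p

IsMaxPathWeight : (ℕ → ℕ → ℕ) → ℕ → ℕ → ℕ → ℕ → Set
IsMaxPathWeight D b c k m =
  (∀ (Π : Path b c k 1) → weight D Π ≤ m) × Σ (Path b c k 1) (λ Π → weight D Π ≡ m)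

-- In a weakly decreasing column, an entry ℓ > π_{b+1,j} = 0 that occurs at all has a unique
-- last occurrence, i.e. a unique row i with π_ij = ℓ > π_{i+1,j}; summing over the columns and
-- exchanging the two sums gives (i).
-- For (ii) let G(i,ℓ) = #{j : π_ij ≥ ℓ}. As rows decrease, {j : π_ij > ℓ} and {j : π_{i+1,j} ≥ ℓ}
-- are initial segments, so their union has G(i,ℓ+1) ⊔ G(i+1,ℓ) elements, and the remaining
-- columns with π_ij ≥ ℓ are exactly those counted by d_iℓ (using π_{i+1,j} ≤ π_ij). Thus
-- G(i,ℓ) = d_iℓ + max(G(i,ℓ+1), G(i+1,ℓ)): the Bellman recursion for maximal path weights,
-- with G vanishing below row b and beyond column c. Finally λ_k = G(k,1).

module Submission where

open import Defs
open import Data.Nat using (ℕ; _≤_)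
open import Data.Product using (_×_)
open import Relation.Binary.PropositionalEquality using (_≡_)

open import Data.Nat using (zero; suc; _+_; _<_; _≤ᵇ_; _<ᵇ_; _≡ᵇ_; _⊔_; _≤‴_; ≤‴-refl; ≤‴-step; z≤n; s≤s; z<s; _≟_)
open import Data.Nat.Properties
open import Algebra.Properties.CommutativeSemigroup +-commutativeSemigroup using (interchange)
open import Data.Bool using (Bool; true; false; _∧_; _∨_; if_then_else_; T)
open import Data.Bool.Properties using (T-∨; ∧-identityʳ; ∧-zeroʳ)
open import Data.Unit using (tt)
open import Data.Empty using (⊥-elim)
open import Data.Product using (Σ; _,_)
open import Data.Sum using (inj₁; inj₂)
import Data.Sum as Sum
open import Function.Base using (_∘_)
open import Function.Bundles using (Equivalence)
open import Relation.Nullary using (¬_; yes; no; Reflects; ofʸ; ofⁿ; proof)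
open import Relation.Nullary.Decidable using (T?)
open import Relation.Nullary.Reflects using (det)
open import Relation.Binary using (tri<; tri≈; tri>)
open import Relation.Binary.PropositionalEquality using (refl; sym; trans; cong; cong₂; subst; module ≡-Reasoning)

open ≡-Reasoning

toℕ : Bool → ℕ
toℕ b = if b then 1 else 0

≡ᵇ-reflects-≡ : ∀ m n → Reflects (m ≡ n) (m ≡ᵇ n)
≡ᵇ-reflects-≡ m n = proof (m ≟ n)

reflects-true : ∀ {P : Set} {b} → Reflects P b → P → b ≡ true
reflects-true r p = det r (ofʸ p)

reflects-false : ∀ {P : Set} {b} → Reflects P b → ¬ P → b ≡ false
reflects-false r ¬p = det r (ofⁿ ¬p)


toℕ-<ᵇ+toℕ-≤ᵇ≡1 : ∀ m n → toℕ (m <ᵇ n) + toℕ (n ≤ᵇ m) ≡ 1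
toℕ-<ᵇ+toℕ-≤ᵇ≡1 m n with m <ᵇ n | <ᵇ-reflects-< m n | n ≤ᵇ m | ≤ᵇ-reflects-≤ n m
... | true  | ofʸ m<n | true  | ofʸ n≤m = ⊥-elim (<⇒≱ m<n n≤m)
... | true  | _       | false | _       = refl
... | false | _       | true  | _       = refl
... | false | ofⁿ m≮n | false | ofⁿ n≰m = ⊥-elim (n≰m (≮⇒≥ m≮n))

≤ᵇ-split : ∀ ℓ x y → y ≤ x →
  toℕ (ℓ ≤ᵇ x) ≡ toℕ ((x ≡ᵇ ℓ) ∧ (y <ᵇ ℓ)) + toℕ ((ℓ <ᵇ x) ∨ (ℓ ≤ᵇ y))
≤ᵇ-split ℓ x y y≤x with <-cmp ℓ x
... | tri< ℓ<x x≢ℓ _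
  rewrite reflects-true (≤ᵇ-reflects-≤ ℓ x) (<⇒≤ ℓ<x)
        | reflects-false (≡ᵇ-reflects-≡ x ℓ) (x≢ℓ ∘ sym)
        | reflects-true (<ᵇ-reflects-< ℓ x) ℓ<x = refl
... | tri> ℓ≰x x≢ℓ x<ℓ
  rewrite reflects-false (≤ᵇ-reflects-≤ ℓ x) (<⇒≱ x<ℓ)
        | reflects-false (≡ᵇ-reflects-≡ x ℓ) (x≢ℓ ∘ sym)
        | reflects-false (<ᵇ-reflects-< ℓ x) ℓ≰x
        | reflects-false (≤ᵇ-reflects-≤ ℓ y) (<⇒≱ (≤-<-trans y≤x x<ℓ)) = refl
... | tri≈ _ refl _
  rewrite reflects-true (≤ᵇ-reflects-≤ ℓ ℓ) ≤-refl
        | reflects-true (≡ᵇ-reflects-≡ ℓ ℓ) refl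
        | reflects-false (<ᵇ-reflects-< ℓ ℓ) (<-irrefl refl) = sym (toℕ-<ᵇ+toℕ-≤ᵇ≡1 y ℓ)

sumUpTo-cong : ∀ {f g} → (∀ i → 1 ≤ i → f i ≡ g i) → ∀ n → sumUpTo f n ≡ sumUpTo g n
sumUpTo-cong f≗g zero    = refl
sumUpTo-cong f≗g (suc n) = cong₂ _+_ (f≗g (suc n) z<s) (sumUpTo-cong f≗g n)

sumUpTo-zero : ∀ n → sumUpTo (λ _ → 0) n ≡ 0
sumUpTo-zero zero    = refl
sumUpTo-zero (suc n) = sumUpTo-zero n

sumUpTo-distrib-+ : ∀ f g n → sumUpTo (λ i → f i + g i) n ≡ sumUpTo f n + sumUpTo g n
sumUpTo-distrib-+ f g zero    = refl
sumUpTo-distrib-+ f g (suc n) = begin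
  f (suc n) + g (suc n) + sumUpTo (λ i → f i + g i) n
    ≡⟨ cong (f (suc n) + g (suc n) +_) (sumUpTo-distrib-+ f g n) ⟩
  f (suc n) + g (suc n) + (sumUpTo f n + sumUpTo g n)
    ≡⟨ interchange (f (suc n)) (g (suc n)) (sumUpTo f n) (sumUpTo g n) ⟩
  f (suc n) + sumUpTo f n + (g (suc n) + sumUpTo g n) ∎

sumUpTo-comm : ∀ (h : ℕ → ℕ → ℕ) m n →
  sumUpTo (λ i → sumUpTo (h i) n) m ≡ sumUpTo (λ j → sumUpTo (λ i → h i j) m) n
sumUpTo-comm h zero    n = sym (sumUpTo-zero n)
sumUpTo-comm h (suc m) n = begin
  sumUpTo (h (suc m)) n + sumUpTo (λ i → sumUpTo (h i) n) m
    ≡⟨ cong (sumUpTo (h (suc m)) n +_) (sumUpTo-comm h m n) ⟩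
  sumUpTo (h (suc m)) n + sumUpTo (λ j → sumUpTo (λ i → h i j) m) n
    ≡⟨ sumUpTo-distrib-+ (h (suc m)) (λ j → sumUpTo (λ i → h i j) m) n ⟨
  sumUpTo (λ j → sumUpTo (λ i → h i j) (suc m)) n ∎

count≡sumUpTo : ∀ f n → count f n ≡ sumUpTo (λ j → toℕ (f j)) n
count≡sumUpTo f zero    = refl
count≡sumUpTo f (suc n) = cong (toℕ (f (suc n)) +_) (count≡sumUpTo f n)

count-+ : ∀ {f g h} → (∀ j → 1 ≤ j → toℕ (f j) ≡ toℕ (g j) + toℕ (h j)) →
  ∀ n → count f n ≡ count g n + count h n
count-+ {f} {g} {h} f≗g+h n = begin
  count f n                                            ≡⟨ count≡sumUpTo f n ⟩
  sumUpTo (λ j → toℕ (f j)) n                          ≡⟨ sumUpTo-cong f≗g+h n ⟩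
  sumUpTo (λ j → toℕ (g j) + toℕ (h j)) n              ≡⟨ sumUpTo-distrib-+ _ _ n ⟩
  sumUpTo (λ j → toℕ (g j)) n + sumUpTo (λ j → toℕ (h j)) n
    ≡⟨ cong₂ _+_ (count≡sumUpTo g n) (count≡sumUpTo h n) ⟨
  count g n + count h n                                ∎

count-≤ : ∀ f n → count f n ≤ n
count-≤ f zero = z≤n
count-≤ f (suc n) with f (suc n)
... | true  = s≤s (count-≤ f n)
... | false = m≤n⇒m≤1+n (count-≤ f n)

count-true : ∀ f n → T (f (suc n)) → count f (suc n) ≡ suc (count f n)
count-true f n fₙ with f (suc n)
... | true = refl

count-false : ∀ f n → ¬ T (f (suc n)) → count f (suc n) ≡ count f n
count-false f n ¬fₙ with f (suc n)
... | true  = ⊥-elim (¬fₙ tt)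
... | false = refl

count-none : ∀ {f} → (∀ j → 1 ≤ j → ¬ T (f j)) → ∀ n → count f n ≡ 0
count-none ¬f zero    = refl
count-none {f} ¬f (suc n) = trans (count-false f n (¬f (suc n) z<s)) (count-none ¬f n)

DownClosed : (ℕ → Bool) → Set
DownClosed f = ∀ j → 1 ≤ j → T (f (suc j)) → T (f j)

DownClosed-∨ : ∀ {f g} → DownClosed f → DownClosed g → DownClosed (λ j → f j ∨ g j)
DownClosed-∨ df dg j 1≤j t =
  Equivalence.from T-∨ (Sum.map (df j 1≤j) (dg j 1≤j) (Equivalence.to T-∨ t))

count-downClosed : ∀ {f} → DownClosed f → ∀ n → T (f n) → count f n ≡ n
count-downClosed     df zero          _  = refl
count-downClosed {f} df (suc zero)    fₙ = count-true f 0 fₙ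
count-downClosed {f} df (suc (suc n)) fₙ =
  trans (count-true f (suc n) fₙ) (cong suc (count-downClosed df (suc n) (df (suc n) z<s fₙ)))

count-∨ : ∀ {f g} → DownClosed f → DownClosed g →
  ∀ n → count (λ j → f j ∨ g j) n ≡ count f n ⊔ count g n
count-∨ df dg zero = refl
count-∨ {f} {g} df dg (suc n) with T? (f (suc n)) | T? (g (suc n))
... | yes fₙ | _ = begin
  count (λ j → f j ∨ g j) (suc n) ≡⟨ count-downClosed (DownClosed-∨ df dg) (suc n) (Equivalence.from T-∨ (inj₁ fₙ)) ⟩
  suc n                           ≡⟨ m≥n⇒m⊔n≡m (count-≤ g (suc n)) ⟨
  suc n ⊔ count g (suc n)         ≡⟨ cong (_⊔ count g (suc n)) (count-downClosed df (suc n) fₙ) ⟨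
  count f (suc n) ⊔ count g (suc n) ∎
... | no _ | yes gₙ = begin
  count (λ j → f j ∨ g j) (suc n) ≡⟨ count-downClosed (DownClosed-∨ df dg) (suc n) (Equivalence.from T-∨ (inj₂ gₙ)) ⟩
  suc n                           ≡⟨ m≤n⇒m⊔n≡n (count-≤ f (suc n)) ⟨
  count f (suc n) ⊔ suc n         ≡⟨ cong (count f (suc n) ⊔_) (count-downClosed dg (suc n) gₙ) ⟨
  count f (suc n) ⊔ count g (suc n) ∎
... | no ¬fₙ | no ¬gₙ = begin
  count (λ j → f j ∨ g j) (suc n) ≡⟨ count-false _ n (Sum.[ ¬fₙ , ¬gₙ ] ∘ Equivalence.to T-∨) ⟩
  count (λ j → f j ∨ g j) n       ≡⟨ count-∨ df dg n ⟩
  count f n ⊔ count g n           ≡⟨ cong₂ _⊔_ (count-false f n ¬fₙ) (count-false g n ¬gₙ) ⟨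
  count f (suc n) ⊔ count g (suc n) ∎

module LastOccurrence (a : ℕ → ℕ) (a-antitone : ∀ i → 1 ≤ i → a (suc i) ≤ a i) (ℓ : ℕ) where

  occurs : ℕ → Bool
  occurs = anyUpTo (λ i → a i ≡ᵇ ℓ)

  occurs⇒≤ : ∀ n → T (occurs n) → a (suc n) ≤ ℓ
  occurs⇒≤ (suc n) t with a (suc n) ≡ᵇ ℓ | ≡ᵇ-reflects-≡ (a (suc n)) ℓ
  ... | true  | ofʸ aₙ₊₁≡ℓ = ≤-trans (a-antitone (suc n) z<s) (≤-reflexive aₙ₊₁≡ℓ)
  ... | false | _          = ≤-trans (a-antitone (suc n) z<s) (occurs⇒≤ n t)

  isLast-step : ∀ n →
    toℕ ((a (suc n) ≡ᵇ ℓ) ∧ (a (suc (suc n)) <ᵇ ℓ)) + toℕ (occurs n ∧ (a (suc n) <ᵇ ℓ))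
      ≡ toℕ (occurs (suc n) ∧ (a (suc (suc n)) <ᵇ ℓ))
  isLast-step n with a (suc n) ≡ᵇ ℓ | ≡ᵇ-reflects-≡ (a (suc n)) ℓ
  ... | true  | ofʸ aₙ₊₁≡ℓ
    rewrite aₙ₊₁≡ℓ | reflects-false (<ᵇ-reflects-< ℓ ℓ) (<-irrefl refl) | ∧-zeroʳ (occurs n) = +-identityʳ _
  ... | false | ofⁿ aₙ₊₁≢ℓ with occurs n | occurs⇒≤ n
  ...   | false | _      = refl
  ...   | true  | aₙ₊₁≤ℓ = cong toℕ (trans (reflects-true (<ᵇ-reflects-< _ ℓ) aₙ₊₁<ℓ)
                                          (sym (reflects-true (<ᵇ-reflects-< _ ℓ) aₙ₊₂<ℓ)))
    where
    aₙ₊₁<ℓ : a (suc n) < ℓ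
    aₙ₊₁<ℓ = ≤∧≢⇒< (aₙ₊₁≤ℓ tt) aₙ₊₁≢ℓ
    aₙ₊₂<ℓ : a (suc (suc n)) < ℓ
    aₙ₊₂<ℓ = ≤-<-trans (a-antitone (suc n) z<s) aₙ₊₁<ℓ

  sum-isLast : ∀ n →
    sumUpTo (λ i → toℕ ((a i ≡ᵇ ℓ) ∧ (a (suc i) <ᵇ ℓ))) n ≡ toℕ (occurs n ∧ (a (suc n) <ᵇ ℓ))
  sum-isLast zero    = refl
  sum-isLast (suc n) =
    trans (cong (toℕ ((a (suc n) ≡ᵇ ℓ) ∧ (a (suc (suc n)) <ᵇ ℓ)) +_) (sum-isLast n)) (isLast-step n)

  sum-isLast≡occurs : ∀ n → a (suc n) < ℓ →
    sumUpTo (λ i → toℕ ((a i ≡ᵇ ℓ) ∧ (a (suc i) <ᵇ ℓ))) n ≡ toℕ (occurs n)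
  sum-isLast≡occurs n aₙ₊₁<ℓ = begin
    sumUpTo (λ i → toℕ ((a i ≡ᵇ ℓ) ∧ (a (suc i) <ᵇ ℓ))) n ≡⟨ sum-isLast n ⟩
    toℕ (occurs n ∧ (a (suc n) <ᵇ ℓ))  ≡⟨ cong (λ x → toℕ (occurs n ∧ x)) (reflects-true (<ᵇ-reflects-< _ ℓ) aₙ₊₁<ℓ) ⟩
    toℕ (occurs n ∧ true)              ≡⟨ cong toℕ (∧-identityʳ (occurs n)) ⟩
    toℕ (occurs n)                     ∎

module MaxPathWeight (D G : ℕ → ℕ → ℕ) {b c : ℕ}
  (G-bellman : ∀ {i ℓ} → 1 ≤ i → 1 ≤ ℓ → G i ℓ ≡ D i ℓ + (G i (suc ℓ) ⊔ G (suc i) ℓ))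
  (G-belowLastRow : ∀ {ℓ} → 1 ≤ ℓ → G (suc b) ℓ ≡ 0)
  (G-pastLastColumn : ∀ {i} → 1 ≤ i → G i (suc c) ≡ 0)
  where

  D+right≤G : ∀ {i ℓ} → 1 ≤ i → 1 ≤ ℓ → D i ℓ + G i (suc ℓ) ≤ G i ℓ
  D+right≤G {i} {ℓ} 1≤i 1≤ℓ =
    subst (D i ℓ + G i (suc ℓ) ≤_) (sym (G-bellman 1≤i 1≤ℓ)) (+-monoʳ-≤ (D i ℓ) (m≤m⊔n _ _))

  D+down≤G : ∀ {i ℓ} → 1 ≤ i → 1 ≤ ℓ → D i ℓ + G (suc i) ℓ ≤ G i ℓ
  D+down≤G {i} {ℓ} 1≤i 1≤ℓ =
    subst (D i ℓ + G (suc i) ℓ ≤_) (sym (G-bellman 1≤i 1≤ℓ)) (+-monoʳ-≤ (D i ℓ) (m≤n⊔m _ _))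

  weight≤G : ∀ {i ℓ} (p : Path b c i ℓ) → 1 ≤ i → 1 ≤ ℓ → weight D p ≤ G i ℓ
  weight≤G stop 1≤b 1≤c = ≤-trans (m≤m+n (D b c) _) (D+down≤G 1≤b 1≤c)
  weight≤G {i} {ℓ} (down p) 1≤i 1≤ℓ =
    ≤-trans (+-monoʳ-≤ (D i ℓ) (weight≤G p z<s 1≤ℓ)) (D+down≤G 1≤i 1≤ℓ)
  weight≤G {i} {ℓ} (right p) 1≤i 1≤ℓ =
    ≤-trans (+-monoʳ-≤ (D i ℓ) (weight≤G p 1≤i z<s)) (D+right≤G 1≤i 1≤ℓ)

  OptimalPath : ℕ → ℕ → Set
  OptimalPath i ℓ = Σ (Path b c i ℓ) (λ p → weight D p ≡ G i ℓ)

  optimal-stop : 1 ≤ b → 1 ≤ c → OptimalPath b c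
  optimal-stop 1≤b 1≤c = stop , sym (begin
    G b c                                ≡⟨ G-bellman 1≤b 1≤c ⟩
    D b c + (G b (suc c) ⊔ G (suc b) c)  ≡⟨ cong₂ (λ x y → D b c + (x ⊔ y)) (G-pastLastColumn 1≤b) (G-belowLastRow 1≤c) ⟩
    D b c + 0                            ≡⟨ +-identityʳ (D b c) ⟩
    D b c                                ∎)

  optimal-down : ∀ {i ℓ} → 1 ≤ i → 1 ≤ ℓ → G i (suc ℓ) ≤ G (suc i) ℓ →
    OptimalPath (suc i) ℓ → OptimalPath i ℓ
  optimal-down {i} {ℓ} 1≤i 1≤ℓ right≤down (p , wp) = down p , (begin
    D i ℓ + weight D p                   ≡⟨ cong (D i ℓ +_) wp ⟩
    D i ℓ + G (suc i) ℓ                  ≡⟨ cong (D i ℓ +_) (m≤n⇒m⊔n≡n right≤down) ⟨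
    D i ℓ + (G i (suc ℓ) ⊔ G (suc i) ℓ)  ≡⟨ G-bellman 1≤i 1≤ℓ ⟨
    G i ℓ                                ∎)

  optimal-right : ∀ {i ℓ} → 1 ≤ i → 1 ≤ ℓ → G (suc i) ℓ ≤ G i (suc ℓ) →
    OptimalPath i (suc ℓ) → OptimalPath i ℓ
  optimal-right {i} {ℓ} 1≤i 1≤ℓ down≤right (p , wp) = right p , (begin
    D i ℓ + weight D p                   ≡⟨ cong (D i ℓ +_) wp ⟩
    D i ℓ + G i (suc ℓ)                  ≡⟨ cong (D i ℓ +_) (m≥n⇒m⊔n≡m down≤right) ⟨
    D i ℓ + (G i (suc ℓ) ⊔ G (suc i) ℓ)  ≡⟨ G-bellman 1≤i 1≤ℓ ⟨
    G i ℓ                                ∎)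

  optimalPath : ∀ {i ℓ} → i ≤‴ b → ℓ ≤‴ c → 1 ≤ i → 1 ≤ ℓ → OptimalPath i ℓ
  optimalPath ≤‴-refl ≤‴-refl 1≤b 1≤c = optimal-stop 1≤b 1≤c
  optimalPath i≡b@≤‴-refl (≤‴-step ℓ<c) 1≤b 1≤ℓ =
    optimal-right 1≤b 1≤ℓ (≤-trans (≤-reflexive (G-belowLastRow 1≤ℓ)) z≤n) (optimalPath i≡b ℓ<c 1≤b z<s)
  optimalPath (≤‴-step i<b) ℓ≡c@≤‴-refl 1≤i 1≤c =
    optimal-down 1≤i 1≤c (≤-trans (≤-reflexive (G-pastLastColumn 1≤i)) z≤n) (optimalPath i<b ℓ≡c z<s 1≤c)
  optimalPath {i} {ℓ} (≤‴-step i<b) (≤‴-step ℓ<c) 1≤i 1≤ℓ with ≤-total (G i (suc ℓ)) (G (suc i) ℓ)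
  ... | inj₁ right≤down = optimal-down 1≤i 1≤ℓ right≤down (optimalPath i<b (≤‴-step ℓ<c) z<s 1≤ℓ)
  ... | inj₂ down≤right = optimal-right 1≤i 1≤ℓ down≤right (optimalPath (≤‴-step i<b) ℓ<c 1≤i z<s)

  G-isMaxPathWeight : ∀ {k} → 1 ≤ k → k ≤ b → 1 ≤ c → IsMaxPathWeight D b c k (G k 1)
  G-isMaxPathWeight 1≤k k≤b 1≤c =
    (λ p → weight≤G p 1≤k ≤-refl) , optimalPath (≤⇒≤‴ k≤b) (≤⇒≤‴ 1≤c) 1≤k ≤-refl

module _ (π : PlanePartition) where

  colsContaining≡colSum : ∀ {b ℓ} → AtMostRows π b → 1 ≤ ℓ → colsContaining π b ℓ ≡ colSum (Φ π) b ℓ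
  colsContaining≡colSum {b} {ℓ} rows 1≤ℓ = begin
    colsContaining π b ℓ
      ≡⟨ count≡sumUpTo _ (width π) ⟩
    sumUpTo (λ j → toℕ (anyUpTo (λ i → entry π i j ≡ᵇ ℓ) b)) (width π)
      ≡⟨ sumUpTo-cong (λ j 1≤j → sym (column-sum j 1≤j)) (width π) ⟩
    sumUpTo (λ j → sumUpTo (λ i → isLast i j) b) (width π)
      ≡⟨ sumUpTo-comm isLast b (width π) ⟨
    sumUpTo (λ i → sumUpTo (isLast i) (width π)) b
      ≡⟨ sumUpTo-cong (λ i _ → sym (count≡sumUpTo _ (width π))) b ⟩
    colSum (Φ π) b ℓ ∎
    where
    isLast : ℕ → ℕ → ℕ
    isLast i j = toℕ ((entry π i j ≡ᵇ ℓ) ∧ (entry π (suc i) j <ᵇ ℓ))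

    column-sum : ∀ j → 1 ≤ j → sumUpTo (λ i → isLast i j) b ≡ toℕ (anyUpTo (λ i → entry π i j ≡ᵇ ℓ) b)
    column-sum j 1≤j = LastOccurrence.sum-isLast≡occurs (λ i → entry π i j)
      (λ i 1≤i → colDec π i j 1≤i 1≤j) ℓ b (subst (_< ℓ) (sym (rows (suc b) j (n<1+n b))) 1≤ℓ)

  atLeast : ℕ → ℕ → ℕ
  atLeast i ℓ = count (λ j → ℓ ≤ᵇ entry π i j) (width π)

  atLeast-downClosed : ∀ {i} ℓ → 1 ≤ i → DownClosed (λ j → ℓ ≤ᵇ entry π i j)
  atLeast-downClosed {i} ℓ 1≤i j 1≤j t = ≤⇒≤ᵇ (≤-trans (≤ᵇ⇒≤ ℓ _ t) (rowDec π i j 1≤i 1≤j))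

  atLeast-bellman : ∀ {i ℓ} → 1 ≤ i →
    atLeast i ℓ ≡ Φ π i ℓ + (atLeast i (suc ℓ) ⊔ atLeast (suc i) ℓ)
  atLeast-bellman {i} {ℓ} 1≤i = begin
    atLeast i ℓ
      ≡⟨ count-+ (λ j 1≤j → ≤ᵇ-split ℓ _ _ (colDec π i j 1≤i 1≤j)) (width π) ⟩
    Φ π i ℓ + count (λ j → (ℓ <ᵇ entry π i j) ∨ (ℓ ≤ᵇ entry π (suc i) j)) (width π)
      ≡⟨ cong (Φ π i ℓ +_) (count-∨ (atLeast-downClosed (suc ℓ) 1≤i) (atLeast-downClosed ℓ z<s) (width π)) ⟩
    Φ π i ℓ + (atLeast i (suc ℓ) ⊔ atLeast (suc i) ℓ) ∎

  atLeast-belowLastRow : ∀ {b ℓ} → AtMostRows π b → 1 ≤ ℓ → atLeast (suc b) ℓ ≡ 0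
  atLeast-belowLastRow {b} {ℓ} rows 1≤ℓ = count-none
    (λ j _ t → <⇒≱ 1≤ℓ (subst (ℓ ≤_) (rows (suc b) j (n<1+n b)) (≤ᵇ⇒≤ ℓ _ t))) (width π)

  atLeast-pastLastColumn : ∀ {c i} → EntriesAtMost π c → 1 ≤ i → atLeast i (suc c) ≡ 0
  atLeast-pastLastColumn {c} {i} ents 1≤i = count-none
    (λ j 1≤j t → <⇒≱ (s≤s (ents i j 1≤i 1≤j)) (≤ᵇ⇒≤ (suc c) _ t)) (width π)

lemma2p5 : (b c : ℕ) → 1 ≤ c → (π : PlanePartition) →
    AtMostRows π b → EntriesAtMost π c →
    (∀ ℓ → 1 ≤ ℓ → colsContaining π b ℓ ≡ colSum (Φ π) b ℓ)
    × (∀ k → 1 ≤ k → k ≤ b → IsMaxPathWeight (Φ π) b c k (shape π k))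
lemma2p5 b c 1≤c π rows ents =
  -- shape π k is atLeast π k 1 by definition: 1 ≤ᵇ x unfolds to 0 <ᵇ x.
  (λ ℓ → colsContaining≡colSum π rows) ,
  (λ k 1≤k k≤b → G-isMaxPathWeight 1≤k k≤b 1≤c)
  where
  open MaxPathWeight (Φ π) (atLeast π) (λ 1≤i _ → atLeast-bellman π 1≤i)
    (atLeast-belowLastRow π rows) (atLeast-pastLastColumn π ents)
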